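{- Let $\ell\ge1$, $0\le k\le\ell$, $B=(b_1,\dots,b_\ell)$ with integers $b_i\ge2$. (i) For every $u\in\Sigma_B$ and $v'\in V'_{\ell,\le k;B}$, $$\sum_{y\in M_{\ell,k}(u)}\nu_B(y,v')=(-1)^{\ell-k}S_{\ell-k}(B(G_{v'}))\,\nu_B(u,v').$$ (ii) For every $v\in V_{\ell,k;B}$ and $v'\in V'_{\ell,\le k;B}$, $$\sum_{u\in M'_{\ell,k;B}(v)}\nu_B(u,v')=(-1)^{\ell-k}\nu_B(v,v').$$
   Context: For an integer $b\ge2$ let $\Sigma_b=\{0,\dots,b-1\}$, $\Delta_b=\Sigma_b\cup\{g\}$ ($g$ a gap symbol), $\Gamma_b=\Delta_b\setminus\{0\}$; $\Sigma_B=\prod_i\Sigma_{b_i}$, $\Delta_B=\prod_i\Delta_{b_i}$, $\Gamma_B=\prod_i\Gamma_{b_i}$, elements written as words. For $v\in\Delta_B$, $G_v=\{i:v_i=g\}$. $V_{\ell,k;B}=\{v\in\Delta_B:|G_v|=\ell-k\}$, $V'_{\ell,m;B}=\{v\in\Gamma_B:|G_v|=\ell-m\}$, $V'_{\ell,\le k;B}=\bigcup_{m=0}^kV'_{\ell,m;B}$. $u\in\Sigma_B$ and $v\in\Delta_B$ are matchable if $u_i=v_i$ whenever $v_i\ne g$; $M_{\ell,k}(u)$ is the set of $v\in V_{\ell,k;B}$ matchable with $u$, and $M'_{\ell,k;B}(v)$ the set of $u\in\Sigma_B$ matchable with $v$. For $X=\{x_1<\dots<x_n\}$, $B(X)=(b_{x_1},\dots,b_{x_n})$;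 $S_j$ is the $j$-th elementary symmetric polynomial ($S_0=1$). On $\Delta_{b_i}$ use the order $0\prec1\prec\cdots\prec b_i-1\prec g$ and define $\nu_i(x,y)=-b_i$ if $x=y=g$; $-y$ if $x=y\ne g$; $1$ if $x\prec y$; $0$ if $x\succ y$. $\nu_B(x,y)=\prod_{i=1}^\ell\nu_i(x_i,y_i)$. -}

module Defs where

open import Data.Nat as ℕ using (ℕ; zero; suc; _≤_; _∸_)
open import Data.Fin using (Fin; zero; suc; toℕ)
import Data.Fin.Properties as FinP
open import Data.Integer as ℤ using (ℤ; +_; -_; _+_; _*_)
open import Data.List using (List; []; _∷_; map; filter; length; concatMap; foldr)
open import Data.Sum using (_⊎_)
open import Data.Product using (_×_)
open import Relation.Nullary using (Dec; yes; no; ¬_)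
open import Relation.Nullary.Decidable using (_⊎-dec_; ¬?)
open import Relation.Binary.PropositionalEquality using (_≡_; refl; cong)

data Δ (b : ℕ) : Set where
  sym : Fin b → Δ b
  gap : Δ b

_≟Δ_ : ∀ {b} (x y : Δ b) → Dec (x ≡ y)
sym x ≟Δ sym y with x FinP.≟ y
... | yes refl = yes refl
... | no x≢y = no (λ { refl → x≢y refl })
sym x ≟Δ gap = no (λ ())
gap ≟Δ sym y = no (λ ())
gap ≟Δ gap = yes refl

ΣW : (ℓ : ℕ) → (Fin ℓ → ℕ) → Set
ΣW ℓ B = (i : Fin ℓ) → Fin (B i)

ΔW : (ℓ : ℕ) → (Fin ℓ → ℕ) → Set
ΔW ℓ B = (i : Fin ℓ) → Δ (B i)

emb : ∀ {ℓ B} → ΣW ℓ B → ΔW ℓ B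
emb u i = sym (u i)

IsZero : ∀ {b} → Δ b → Set
IsZero (sym x) = toℕ x ≡ 0
IsZero gap = Data.Empty.⊥ where import Data.Empty

InΓ : ∀ {ℓ B} → ΔW ℓ B → Set
InΓ v = ∀ i → ¬ IsZero (v i)

consΣ : ∀ {ℓ} {B : Fin (suc ℓ) → ℕ} → Fin (B zero) → ΣW ℓ (λ i → B (suc i)) → ΣW (suc ℓ) B
consΣ x w zero = x
consΣ x w (suc i) = w i

consΔ : ∀ {ℓ} {B : Fin (suc ℓ) → ℕ} → Δ (B zero) → ΔW ℓ (λ i → B (suc i)) → ΔW (suc ℓ) B
consΔ x w zero = x
consΔ x w (suc i) = w i

allFin : (n : ℕ) → List (Fin n)
allFin n = Data.List.allFin n where import Data.List

allΔ₁ : (b : ℕ) → List (Δ b)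
allΔ₁ b = gap ∷ map sym (allFin b)

-- enumerations of all of Σ_B and all of Δ_B (each element exactly once)
allΣ : (ℓ : ℕ) (B : Fin ℓ → ℕ) → List (ΣW ℓ B)
allΣ zero B = (λ ()) ∷ []
allΣ (suc ℓ) B = concatMap (λ x → map (consΣ {B = B} x) (allΣ ℓ (λ i → B (suc i)))) (allFin (B zero))

allΔ : (ℓ : ℕ) (B : Fin ℓ → ℕ) → List (ΔW ℓ B)
allΔ zero B = (λ ()) ∷ []
allΔ (suc ℓ) B = concatMap (λ x → map (consΔ {B = B} x) (allΔ ℓ (λ i → B (suc i)))) (allΔ₁ (B zero))

-- G_v as the increasing list of gap positions; |G_v|; B(G_v)
G : ∀ {ℓ B} → ΔW ℓ B → List (Fin ℓ)
G {ℓ} v = filter (λ i → v i ≟Δ gap) (allFin ℓ)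

gapCount : ∀ {ℓ B} → ΔW ℓ B → ℕ
gapCount v = length (G v)

BofG : ∀ {ℓ} (B : Fin ℓ → ℕ) → ΔW ℓ B → List ℕ
BofG B v = map B (G v)

Matchable : ∀ {ℓ B} → ΣW ℓ B → ΔW ℓ B → Set
Matchable u v = ∀ i → v i ≡ gap ⊎ v i ≡ sym (u i)

matchable? : ∀ {ℓ B} (u : ΣW ℓ B) (v : ΔW ℓ B) → Dec (Matchable u v)
matchable? u v = FinP.all? (λ i → (v i ≟Δ gap) ⊎-dec (v i ≟Δ sym (u i)))

S : ℕ → List ℕ → ℤ
S zero xs = + 1
S (suc j) [] = + 0
S (suc j) (x ∷ xs) = + x * S j xs + S (suc j) xs

-- ν_i on Δ_b with order 0 ≺ 1 ≺ … ≺ b-1 ≺ g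
ν : (b : ℕ) → Δ b → Δ b → ℤ
ν b gap gap = - (+ b)
ν b (sym x) gap = + 1
ν b gap (sym y) = + 0
ν b (sym x) (sym y) with x FinP.≟ y
... | yes _ = - (+ toℕ y)
... | no _ with toℕ x ℕ.<? toℕ y
...   | yes _ = + 1
...   | no _ = + 0

productℤ : List ℤ → ℤ
productℤ = foldr _*_ (+ 1)

sumℤ : List ℤ → ℤ
sumℤ = foldr _+_ (+ 0)

νB : ∀ {ℓ} (B : Fin ℓ → ℕ) → ΔW ℓ B → ΔW ℓ B → ℤ
νB {ℓ} B x y = productℤ (map (λ i → ν (B i) (x i) (y i)) (allFin ℓ))

M : ∀ {ℓ} (B : Fin ℓ → ℕ) (k : ℕ) → ΣW ℓ B → List (ΔW ℓ B)
M {ℓ} B k u = filter (λ v → (gapCount v ℕ.≟ ℓ ∸ k) Relation.Nullary.Decidable.×-dec matchable? u v) (allΔ ℓ B)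

M′ : ∀ {ℓ} (B : Fin ℓ → ℕ) → ΔW ℓ B → List (ΣW ℓ B)
M′ {ℓ} B v = filter (λ u → matchable? u v) (allΣ ℓ B)

InV : ∀ {ℓ B} → ℕ → ΔW ℓ B → Set
InV {ℓ} k v = gapCount v ≡ ℓ ∸ k

InV′≤ : ∀ {ℓ B} → ℕ → ΔW ℓ B → Set
InV′≤ {ℓ} k v = InΓ v × Data.Product.∃ (λ m → m ≤ k × gapCount v ≡ ℓ ∸ m)
  where import Data.Product

-- Both sums factor over the coordinates, because ν_B is a product and matchability
-- is checked letter by letter.
-- (ii) The i-th factor is ν(v_i, v′_i) if v_i is a letter; if v_i = g it is
-- Σ_x ν(x, v′_i), which is b_i = −ν(g, g) when v′_i = g, and #{x < y} − y = 0 = −ν(g, y)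
-- when v′_i = y.  Hence the sum is (−1)^|G_v| ν_B(v, v′).
-- (i) Grouping the words y ∈ Δ_B by their number of gaps, the sum is the coefficient of
-- t^(ℓ−k) in ∏_i (ν(u_i, v′_i) + ν(g, v′_i) t).  Here ν(g, v′_i) = −b_i and ν(u_i, v′_i) = 1
-- when v′_i = g, while ν(g, v′_i) = 0 otherwise, so this coefficient is
-- (−1)^(ℓ−k) S_(ℓ−k)(B(G_v′)) ν_B(u, v′).
-- Neither identity needs 1 ≤ ℓ, k ≤ ℓ, b_i ≥ 2 or v′ ∈ V′_{ℓ,≤k;B}.

module Submission where

open import Defs
open import Data.Nat as ℕ using (ℕ; zero; suc; _≤_; _∸_; z≤n; s≤s)
import Data.Nat.Properties as ℕP
open import Data.Fin using (Fin; zero; suc; toℕ)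
import Data.Fin.Properties as FinP
open import Data.Integer using (ℤ; _*_; _^_; -_; +_; _+_; -1ℤ)
import Data.Integer.Properties as ℤP
open import Data.Integer.Tactic.RingSolver using (solve-∀)
open import Data.List using (List; []; _∷_; map; filter; length; concatMap; tabulate; foldr; _++_)
import Data.List.Properties as LP
import Data.Vec.Functional as Vector
open import Data.Bool using (if_then_else_)
open import Data.Product using (_×_; _,_)
open import Data.Sum using (_⊎_; inj₂)
open import Function using (_∘_; id)
open import Relation.Nullary using (Dec; yes; no; ¬_; does)
open import Relation.Nullary.Decidable using (_⊎-dec_; _×-dec_; dec-true; dec-false)
open import Relation.Unary using (Pred; Decidable)
open import Relation.Binary.PropositionalEquality
  using (_≡_; refl; cong; cong₂; trans; module ≡-Reasoning) renaming (sym to ≡-sym)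

open import Algebra.Properties.Semiring.Sum ℤP.+-*-semiring
  using (sum-syntax; sum-cong-≗; sum-replicate-zero; ∑-distrib-+; *-distribʳ-sum)
open import Algebra.Properties.CommutativeSemigroup ℤP.*-commutativeSemigroup
  using () renaming (x∙yz≈y∙xz to *-left-comm)
open import Algebra.Properties.CommutativeMonoid.Sum ℤP.*-1-commutativeMonoid
  using () renaming (sum to ∏; sum-cong-≗ to ∏-cong-≗; ∑-distrib-+ to ∏-distrib-*)

infixl 10 ∏-syntax

∏-syntax : ∀ n → (Fin n → ℤ) → ℤ
∏-syntax _ = ∏

syntax ∏-syntax n (λ i → x) = ∏[ i < n ] x

indicator : ∀ {p} {P : Set p} → Dec P → ℤ
indicator d = if does d then + 1 else + 0

indicator-yes : ∀ {p} {P : Set p} → P → (d : Dec P) → indicator d ≡ + 1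
indicator-yes p d = cong (λ b → if b then + 1 else + 0) (dec-true d p)

indicator-no : ∀ {p} {P : Set p} → ¬ P → (d : Dec P) → indicator d ≡ + 0
indicator-no ¬p d = cong (λ b → if b then + 1 else + 0) (dec-false d ¬p)

indicator-cong : ∀ {p q} {P : Set p} {Q : Set q} → (P → Q) → (Q → P) →
  (d : Dec P) (e : Dec Q) → indicator d ≡ indicator e
indicator-cong to from (yes p) e = ≡-sym (indicator-yes (to p) e)
indicator-cong to from (no ¬p) e = ≡-sym (indicator-no (¬p ∘ from) e)

indicator-× : ∀ {p q} {P : Set p} {Q : Set q} (d : Dec P) (e : Dec Q) →
  indicator (d ×-dec e) ≡ indicator d * indicator e
indicator-× (yes _) (yes _) = refl
indicator-× (yes _) (no _)  = refl
indicator-× (no _)  (yes _) = refl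
indicator-× (no _)  (no _)  = refl

indicator-all? : ∀ {n p} {P : Pred (Fin n) p} (P? : Decidable P) →
  indicator (FinP.all? P?) ≡ ∏[ i < n ] indicator (P? i)
indicator-all? {zero} P? = indicator-yes (λ ()) (FinP.all? P?)
indicator-all? {suc n} {P = P} P? = begin
  indicator (FinP.all? P?)
    ≡⟨ indicator-cong split join (FinP.all? P?) (P? zero ×-dec FinP.all? (P? ∘ suc)) ⟩
  indicator (P? zero ×-dec FinP.all? (P? ∘ suc))
    ≡⟨ indicator-× (P? zero) (FinP.all? (P? ∘ suc)) ⟩
  indicator (P? zero) * indicator (FinP.all? (P? ∘ suc))
    ≡⟨ cong (indicator (P? zero) *_) (indicator-all? (P? ∘ suc)) ⟩
  indicator (P? zero) * ∏[ i < n ] indicator (P? (suc i)) ∎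
  where
  open ≡-Reasoning
  split : (∀ i → P i) → P zero × (∀ i → P (suc i))
  split all = all zero , all ∘ suc
  join : P zero × (∀ i → P (suc i)) → ∀ i → P i
  join (p , ps) zero = p
  join (p , ps) (suc i) = ps i

sumOver : ∀ {a} {A : Set a} → List A → (A → ℤ) → ℤ
sumOver xs f = sumℤ (map f xs)

module _ {a} {A : Set a} where

  sumOver-cong : ∀ (xs : List A) {f g : A → ℤ} → (∀ x → f x ≡ g x) → sumOver xs f ≡ sumOver xs g
  sumOver-cong xs f≗g = cong sumℤ (LP.map-cong f≗g xs)

  sumOver-*ˡ : ∀ (xs : List A) c (f : A → ℤ) → sumOver xs (λ x → c * f x) ≡ c * sumOver xs f
  sumOver-*ˡ []       c f = ≡-sym (ℤP.*-zeroʳ c)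
  sumOver-*ˡ (x ∷ xs) c f = trans (cong (_+_ (c * f x)) (sumOver-*ˡ xs c f)) (≡-sym (ℤP.*-distribˡ-+ c (f x) _))

  sumOver-++ : ∀ (xs ys : List A) (f : A → ℤ) → sumOver (xs ++ ys) f ≡ sumOver xs f + sumOver ys f
  sumOver-++ []       ys f = ≡-sym (ℤP.+-identityˡ _)
  sumOver-++ (x ∷ xs) ys f = trans (cong (_+_ (f x)) (sumOver-++ xs ys f)) (≡-sym (ℤP.+-assoc (f x) _ _))

  sumOver-filter : ∀ {p} {P : Pred A p} (P? : Decidable P) (xs : List A) (f : A → ℤ) →
    sumOver (filter P? xs) f ≡ sumOver xs (λ x → indicator (P? x) * f x)
  sumOver-filter P? []       f = refl
  sumOver-filter P? (x ∷ xs) f with P? x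
  ... | yes _ = cong₂ _+_ (≡-sym (ℤP.*-identityˡ (f x))) (sumOver-filter P? xs f)
  ... | no _  = trans (sumOver-filter P? xs f) (≡-sym (ℤP.+-identityˡ _))

  module _ {b} {C : Set b} where

    sumOver-map : ∀ (h : C → A) (xs : List C) (f : A → ℤ) → sumOver (map h xs) f ≡ sumOver xs (f ∘ h)
    sumOver-map h xs f = cong sumℤ (≡-sym (LP.map-∘ xs))

    sumOver-concatMap : ∀ (g : C → List A) (xs : List C) (f : A → ℤ) →
      sumOver (concatMap g xs) f ≡ sumOver xs (λ x → sumOver (g x) f)
    sumOver-concatMap g []       f = refl
    sumOver-concatMap g (x ∷ xs) f =
      trans (sumOver-++ (g x) (concatMap g xs) f) (cong (_+_ (sumOver (g x) f)) (sumOver-concatMap g xs f))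

filter-map : ∀ {a b p} {A : Set a} {C : Set b} {P : Pred A p} (P? : Decidable P) (h : C → A) (xs : List C) →
  filter P? (map h xs) ≡ map h (filter (P? ∘ h) xs)
filter-map P? h []       = refl
filter-map P? h (x ∷ xs) with P? (h x)
... | yes _ = cong (h x ∷_) (filter-map P? h xs)
... | no _  = filter-map P? h xs

foldr-map-allFin : ∀ {a} {A : Set a} (_∙_ : A → A → A) (e : A) {n} (f : Fin n → A) →
  foldr _∙_ e (map f (allFin n)) ≡ Vector.foldr _∙_ e f
foldr-map-allFin {A = A} _∙_ e {n} f = trans (cong (foldr _∙_ e) (LP.map-tabulate {n = n} id f)) (foldr-tabulate f)
  where
  foldr-tabulate : ∀ {n} (f : Fin n → A) → foldr _∙_ e (tabulate f) ≡ Vector.foldr _∙_ e f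
  foldr-tabulate {zero}  f = refl
  foldr-tabulate {suc n} f = cong (f zero ∙_) (foldr-tabulate (f ∘ suc))

sumOver-allFin : ∀ {n} (f : Fin n → ℤ) → sumOver (allFin n) f ≡ ∑[ i < n ] f i
sumOver-allFin = foldr-map-allFin _+_ (+ 0)

νB-∏ : ∀ {ℓ} (B : Fin ℓ → ℕ) (x y : ΔW ℓ B) → νB B x y ≡ ∏[ i < ℓ ] ν (B i) (x i) (y i)
νB-∏ B x y = foldr-map-allFin _*_ (+ 1) (λ i → ν (B i) (x i) (y i))

∑-indicator-point : ∀ {n p} {P : Pred (Fin n) p} (P? : Decidable P) (a : Fin n) →
  (∀ {x} → P x → x ≡ a) → P a → (f : Fin n → ℤ) → ∑[ x < n ] (indicator (P? x) * f x) ≡ f a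
∑-indicator-point {suc n} P? zero only Pa f = begin
  indicator (P? zero) * f zero + ∑[ x < n ] (indicator (P? (suc x)) * f (suc x))
    ≡⟨ cong₂ _+_ (cong (_* f zero) (indicator-yes Pa (P? zero))) (sum-cong-≗ {n} vanish) ⟩
  + 1 * f zero + ∑[ x < n ] (+ 0)
    ≡⟨ cong₂ _+_ (ℤP.*-identityˡ (f zero)) (sum-replicate-zero n) ⟩
  f zero + (+ 0)
    ≡⟨ ℤP.+-identityʳ (f zero) ⟩
  f zero ∎
  where
  open ≡-Reasoning
  vanish : ∀ x → indicator (P? (suc x)) * f (suc x) ≡ + 0
  vanish x = trans (cong (_* f (suc x)) (indicator-no (λ p → FinP.0≢1+n (≡-sym (only p))) (P? (suc x))))
                   (ℤP.*-zeroˡ (f (suc x)))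
∑-indicator-point {suc n} P? (suc a) only Pa f = begin
  indicator (P? zero) * f zero + ∑[ x < n ] (indicator (P? (suc x)) * f (suc x))
    ≡⟨ cong (λ c → c * f zero + ∑[ x < n ] (indicator (P? (suc x)) * f (suc x)))
            (indicator-no (λ p → FinP.0≢1+n (only p)) (P? zero)) ⟩
  + 0 * f zero + ∑[ x < n ] (indicator (P? (suc x)) * f (suc x))
    ≡⟨ ℤP.+-identityˡ _ ⟩
  ∑[ x < n ] (indicator (P? (suc x)) * f (suc x))
    ≡⟨ ∑-indicator-point (P? ∘ suc) a (FinP.suc-injective ∘ only) Pa (f ∘ suc) ⟩
  f (suc a) ∎
  where open ≡-Reasoning

∑-indicator-< : ∀ {b} n → n ≤ b → ∑[ x < b ] indicator (toℕ x ℕ.<? n) ≡ + n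
∑-indicator-< {zero}  zero    z≤n     = refl
∑-indicator-< {suc b} zero    z≤n     =
  trans (sum-cong-≗ {suc b} (λ x → indicator-no ℕP.n≮0 (toℕ x ℕ.<? 0))) (sum-replicate-zero (suc b))
∑-indicator-< {suc b} (suc n) (s≤s n≤b) =
  cong (_+_ (+ 1)) (trans (sum-cong-≗ {b} {y = λ x → indicator (toℕ x ℕ.<? n)} shift) (∑-indicator-< n n≤b))
  where
  shift : ∀ x → indicator (suc (toℕ x) ℕ.<? suc n) ≡ indicator (toℕ x ℕ.<? n)
  shift x = indicator-cong ℕP.≤-pred s≤s (suc (toℕ x) ℕ.<? suc n) (toℕ x ℕ.<? n)

∑-const-1 : ∀ b → ∑[ x < b ] (+ 1) ≡ + b
∑-const-1 zero    = refl
∑-const-1 (suc b) = cong (_+_ (+ 1)) (∑-const-1 b)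

ν-sym-sym : ∀ b (x y : Fin b) →
  ν b (sym x) (sym y) ≡ indicator (toℕ x ℕ.<? toℕ y) + indicator (x FinP.≟ y) * - + toℕ y
ν-sym-sym b x y with x FinP.≟ y
... | yes refl = ≡-sym (begin
  indicator (toℕ x ℕ.<? toℕ x) + + 1 * - + toℕ x
    ≡⟨ cong₂ _+_ (indicator-no (ℕP.n≮n (toℕ x)) (toℕ x ℕ.<? toℕ x)) (ℤP.*-identityˡ _) ⟩
  + 0 + - + toℕ x
    ≡⟨ ℤP.+-identityˡ _ ⟩
  - + toℕ x ∎)
  where open ≡-Reasoning
... | no _ with toℕ x ℕ.<? toℕ y
...   | yes x<y = ≡-sym (cong₂ _+_ (indicator-yes x<y (toℕ x ℕ.<? toℕ y)) refl)
...   | no x≮y  = ≡-sym (cong₂ _+_ (indicator-no x≮y (toℕ x ℕ.<? toℕ y)) refl)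

∑-ν-column : ∀ b (y : Fin b) → ∑[ x < b ] ν b (sym x) (sym y) ≡ + 0
∑-ν-column b y = begin
  ∑[ x < b ] ν b (sym x) (sym y)
    ≡⟨ sum-cong-≗ {b} (λ x → ν-sym-sym b x y) ⟩
  ∑[ x < b ] (indicator (toℕ x ℕ.<? toℕ y) + indicator (x FinP.≟ y) * - + toℕ y)
    ≡⟨ ∑-distrib-+ (λ x → indicator (toℕ x ℕ.<? toℕ y)) (λ x → indicator (x FinP.≟ y) * - + toℕ y) ⟩
  ∑[ x < b ] indicator (toℕ x ℕ.<? toℕ y) + ∑[ x < b ] (indicator (x FinP.≟ y) * - + toℕ y)
    ≡⟨ cong₂ _+_ (∑-indicator-< (toℕ y) (ℕP.<⇒≤ (FinP.toℕ<n y)))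
                 (∑-indicator-point (FinP._≟ y) y id refl (λ _ → - + toℕ y)) ⟩
  + toℕ y + - + toℕ y
    ≡⟨ ℤP.+-inverseʳ (+ toℕ y) ⟩
  + 0 ∎
  where open ≡-Reasoning

sgn : ∀ {b} → Δ b → ℤ
sgn gap     = -1ℤ
sgn (sym _) = + 1

matches? : ∀ {b} (a : Δ b) (x : Fin b) → Dec (a ≡ gap ⊎ a ≡ sym x)
matches? a x = (a ≟Δ gap) ⊎-dec (a ≟Δ sym x)

sym-matches : ∀ {b} {a x : Fin b} → sym a ≡ gap ⊎ sym a ≡ sym x → a ≡ x
sym-matches (inj₂ refl) = refl

∑-matches-sym : ∀ {b} (a : Fin b) (y : Δ b) →
  ∑[ x < b ] (indicator (matches? (sym x) a) * ν b (sym x) y) ≡ ν b (sym a) y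
∑-matches-sym a y = ∑-indicator-point (λ x → matches? (sym x) a) a sym-matches (inj₂ refl) (λ x → ν _ (sym x) y)

∑-matches-ν : ∀ {b} (a y : Δ b) →
  ∑[ x < b ] (indicator (matches? a x) * ν b (sym x) y) ≡ sgn a * ν b a y
∑-matches-ν {b} gap gap =
  trans (∑-const-1 b) (≡-sym (trans (ℤP.-1*i≡-i (- + b)) (ℤP.neg-involutive (+ b))))
∑-matches-ν {b} gap (sym y) = trans (sum-cong-≗ {b} (λ x → ℤP.*-identityˡ _)) (∑-ν-column b y)
∑-matches-ν {b} (sym a) y =
  trans (∑-indicator-point (matches? (sym a)) a (≡-sym ∘ sym-matches) (inj₂ refl) (λ x → ν b (sym x) y))
        (≡-sym (ℤP.*-identityˡ _))

tailΔ : ∀ {ℓ} {B : Fin (suc ℓ) → ℕ} → ΔW (suc ℓ) B → ΔW ℓ (B ∘ suc)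
tailΔ v i = v (suc i)

sym≢gap : ∀ {b} {x : Fin b} → ¬ sym x ≡ gap
sym≢gap ()

module _ {ℓ} {B : Fin (suc ℓ) → ℕ} (v : ΔW (suc ℓ) B) where

  private
    G-suc : filter (λ i → v i ≟Δ gap) (tabulate suc) ≡ map suc (G (tailΔ v))
    G-suc = trans (cong (filter (λ i → v i ≟Δ gap)) (≡-sym (LP.map-tabulate {n = ℓ} id suc)))
                  (filter-map (λ i → v i ≟Δ gap) suc (allFin ℓ))

  G-gap : v zero ≡ gap → G v ≡ zero ∷ map suc (G (tailΔ v))
  G-gap e = trans (LP.filter-accept (λ i → v i ≟Δ gap) e) (cong (zero ∷_) G-suc)

  G-sym : ∀ {x} → v zero ≡ sym x → G v ≡ map suc (G (tailΔ v))
  G-sym e = trans (LP.filter-reject (λ i → v i ≟Δ gap) (λ e′ → sym≢gap (trans (≡-sym e) e′))) G-suc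

  gapCount-gap : v zero ≡ gap → gapCount v ≡ suc (gapCount (tailΔ v))
  gapCount-gap e = trans (cong length (G-gap e)) (cong suc (LP.length-map suc (G (tailΔ v))))

  gapCount-sym : ∀ {x} → v zero ≡ sym x → gapCount v ≡ gapCount (tailΔ v)
  gapCount-sym e = trans (cong length (G-sym e)) (LP.length-map suc (G (tailΔ v)))

  BofG-gap : v zero ≡ gap → BofG B v ≡ B zero ∷ BofG (B ∘ suc) (tailΔ v)
  BofG-gap e = trans (cong (map B) (G-gap e)) (cong (B zero ∷_) (≡-sym (LP.map-∘ (G (tailΔ v)))))

  BofG-sym : ∀ {x} → v zero ≡ sym x → BofG B v ≡ BofG (B ∘ suc) (tailΔ v)
  BofG-sym e = trans (cong (map B) (G-sym e)) (≡-sym (LP.map-∘ (G (tailΔ v))))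

sign-gapCount-suc : ∀ {ℓ} {B : Fin (suc ℓ) → ℕ} (v : ΔW (suc ℓ) B) →
  -1ℤ ^ gapCount v ≡ sgn (v zero) * -1ℤ ^ gapCount (tailΔ v)
sign-gapCount-suc v = go (v zero) refl
  where
  go : ∀ a → v zero ≡ a → -1ℤ ^ gapCount v ≡ sgn a * -1ℤ ^ gapCount (tailΔ v)
  go gap     e = cong (-1ℤ ^_) (gapCount-gap v e)
  go (sym x) e = trans (cong (-1ℤ ^_) (gapCount-sym v e)) (≡-sym (ℤP.*-identityˡ _))

∏-sgn : ∀ {ℓ} {B : Fin ℓ → ℕ} (v : ΔW ℓ B) → ∏[ i < ℓ ] sgn (v i) ≡ -1ℤ ^ gapCount v
∏-sgn {zero}  v = refl
∏-sgn {suc ℓ} v = trans (cong (sgn (v zero) *_) (∏-sgn (tailΔ v))) (≡-sym (sign-gapCount-suc v))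

∑Σ : ∀ ℓ (B : Fin ℓ → ℕ) → (ΣW ℓ B → ℤ) → ℤ
∑Σ ℓ B = sumOver (allΣ ℓ B)

∑Δ : ∀ ℓ (B : Fin ℓ → ℕ) → (ΔW ℓ B → ℤ) → ℤ
∑Δ ℓ B = sumOver (allΔ ℓ B)

∑Σ-suc : ∀ ℓ (B : Fin (suc ℓ) → ℕ) (f : ΣW (suc ℓ) B → ℤ) →
  ∑Σ (suc ℓ) B f ≡ ∑[ x < B zero ] ∑Σ ℓ (B ∘ suc) (f ∘ consΣ x)
∑Σ-suc ℓ B f = begin
  ∑Σ (suc ℓ) B f
    ≡⟨ sumOver-concatMap (λ x → map (consΣ x) (allΣ ℓ (B ∘ suc))) (allFin (B zero)) f ⟩
  sumOver (allFin (B zero)) (λ x → sumOver (map (consΣ x) (allΣ ℓ (B ∘ suc))) f)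
    ≡⟨ sumOver-cong (allFin (B zero)) (λ x → sumOver-map (consΣ x) (allΣ ℓ (B ∘ suc)) f) ⟩
  sumOver (allFin (B zero)) (λ x → ∑Σ ℓ (B ∘ suc) (f ∘ consΣ x))
    ≡⟨ sumOver-allFin (λ x → ∑Σ ℓ (B ∘ suc) (f ∘ consΣ x)) ⟩
  ∑[ x < B zero ] ∑Σ ℓ (B ∘ suc) (f ∘ consΣ x) ∎
  where open ≡-Reasoning

∑Δ-suc : ∀ ℓ (B : Fin (suc ℓ) → ℕ) (f : ΔW (suc ℓ) B → ℤ) →
  ∑Δ (suc ℓ) B f ≡ ∑Δ ℓ (B ∘ suc) (f ∘ consΔ gap) + ∑[ x < B zero ] ∑Δ ℓ (B ∘ suc) (f ∘ consΔ (sym x))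
∑Δ-suc ℓ B f = begin
  ∑Δ (suc ℓ) B f
    ≡⟨ sumOver-concatMap (λ a → map (consΔ a) (allΔ ℓ (B ∘ suc))) (allΔ₁ (B zero)) f ⟩
  sumOver (allΔ₁ (B zero)) (λ a → sumOver (map (consΔ a) (allΔ ℓ (B ∘ suc))) f)
    ≡⟨ sumOver-cong (allΔ₁ (B zero)) (λ a → sumOver-map (consΔ a) (allΔ ℓ (B ∘ suc)) f) ⟩
  sumOver (allΔ₁ (B zero)) (λ a → ∑Δ ℓ (B ∘ suc) (f ∘ consΔ a))
    ≡⟨ cong (_+_ (∑Δ ℓ (B ∘ suc) (f ∘ consΔ gap))) (sumOver-map sym (allFin (B zero)) (λ a → ∑Δ ℓ (B ∘ suc) (f ∘ consΔ a))) ⟩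
  ∑Δ ℓ (B ∘ suc) (f ∘ consΔ gap) + sumOver (allFin (B zero)) (λ x → ∑Δ ℓ (B ∘ suc) (f ∘ consΔ (sym x)))
    ≡⟨ cong (_+_ (∑Δ ℓ (B ∘ suc) (f ∘ consΔ gap))) (sumOver-allFin (λ x → ∑Δ ℓ (B ∘ suc) (f ∘ consΔ (sym x)))) ⟩
  ∑Δ ℓ (B ∘ suc) (f ∘ consΔ gap) + ∑[ x < B zero ] ∑Δ ℓ (B ∘ suc) (f ∘ consΔ (sym x)) ∎
  where open ≡-Reasoning

∑Σ-cong : ∀ ℓ (B : Fin ℓ → ℕ) {f g : ΣW ℓ B → ℤ} → (∀ u → f u ≡ g u) → ∑Σ ℓ B f ≡ ∑Σ ℓ B g
∑Σ-cong ℓ B = sumOver-cong (allΣ ℓ B)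

∑Δ-cong : ∀ ℓ (B : Fin ℓ → ℕ) {f g : ΔW ℓ B → ℤ} → (∀ y → f y ≡ g y) → ∑Δ ℓ B f ≡ ∑Δ ℓ B g
∑Δ-cong ℓ B = sumOver-cong (allΔ ℓ B)

∑Σ-∏ : ∀ ℓ (B : Fin ℓ → ℕ) (f : (i : Fin ℓ) → Fin (B i) → ℤ) →
  ∑Σ ℓ B (λ u → ∏[ i < ℓ ] f i (u i)) ≡ ∏[ i < ℓ ] ∑[ x < B i ] f i x
∑Σ-∏ zero    B f = refl
∑Σ-∏ (suc ℓ) B f = begin
  ∑Σ (suc ℓ) B (λ u → ∏[ i < suc ℓ ] f i (u i))
    ≡⟨ ∑Σ-suc ℓ B (λ u → ∏[ i < suc ℓ ] f i (u i)) ⟩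
  ∑[ x < B zero ] ∑Σ ℓ (B ∘ suc) (λ w → f zero x * ∏[ i < ℓ ] f (suc i) (w i))
    ≡⟨ sum-cong-≗ {B zero} (λ x → sumOver-*ˡ (allΣ ℓ (B ∘ suc)) (f zero x) (λ w → ∏[ i < ℓ ] f (suc i) (w i))) ⟩
  ∑[ x < B zero ] (f zero x * ∑Σ ℓ (B ∘ suc) (λ w → ∏[ i < ℓ ] f (suc i) (w i)))
    ≡⟨ sum-cong-≗ {B zero} (λ x → cong (f zero x *_) (∑Σ-∏ ℓ (B ∘ suc) (f ∘ suc))) ⟩
  ∑[ x < B zero ] (f zero x * ∏[ i < ℓ ] ∑[ x < B (suc i) ] f (suc i) x)
    ≡⟨ *-distribʳ-sum (∏[ i < ℓ ] ∑[ x < B (suc i) ] f (suc i) x) (f zero) ⟨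
  (∑[ x < B zero ] f zero x) * ∏[ i < ℓ ] ∑[ x < B (suc i) ] f (suc i) x ∎
  where open ≡-Reasoning

-- The coefficient of tⁿ in ∏ᵢ (s i + g i · t).
productCoeff : ∀ {ℓ} → ℕ → (Fin ℓ → ℤ) → (Fin ℓ → ℤ) → ℤ
productCoeff {zero}  zero    g s = + 1
productCoeff {zero}  (suc n) g s = + 0
productCoeff {suc ℓ} zero    g s = s zero * productCoeff zero (g ∘ suc) (s ∘ suc)
productCoeff {suc ℓ} (suc n) g s =
  g zero * productCoeff n (g ∘ suc) (s ∘ suc) + s zero * productCoeff (suc n) (g ∘ suc) (s ∘ suc)

productCoeff-cong : ∀ {ℓ} n {g g′ s s′ : Fin ℓ → ℤ} → (∀ i → g i ≡ g′ i) → (∀ i → s i ≡ s′ i) →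
  productCoeff n g s ≡ productCoeff n g′ s′
productCoeff-cong {zero}  zero    g≗g′ s≗s′ = refl
productCoeff-cong {zero}  (suc n) g≗g′ s≗s′ = refl
productCoeff-cong {suc ℓ} zero    g≗g′ s≗s′ =
  cong₂ _*_ (s≗s′ zero) (productCoeff-cong zero (g≗g′ ∘ suc) (s≗s′ ∘ suc))
productCoeff-cong {suc ℓ} (suc n) g≗g′ s≗s′ =
  cong₂ _+_ (cong₂ _*_ (g≗g′ zero) (productCoeff-cong n (g≗g′ ∘ suc) (s≗s′ ∘ suc)))
            (cong₂ _*_ (s≗s′ zero) (productCoeff-cong (suc n) (g≗g′ ∘ suc) (s≗s′ ∘ suc)))

∑Δ-gapCount-∏ : ∀ ℓ (B : Fin ℓ → ℕ) (f : (i : Fin ℓ) → Δ (B i) → ℤ) n →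
  ∑Δ ℓ B (λ y → indicator (gapCount y ℕ.≟ n) * ∏[ i < ℓ ] f i (y i))
    ≡ productCoeff n (λ i → f i gap) (λ i → ∑[ x < B i ] f i (sym x))
∑Δ-gapCount-∏ zero    B f zero    = refl
∑Δ-gapCount-∏ zero    B f (suc n) = refl
∑Δ-gapCount-∏ (suc ℓ) B f n = begin
  ∑Δ (suc ℓ) B F
    ≡⟨ ∑Δ-suc ℓ B F ⟩
  ∑Δ ℓ B′ (F ∘ consΔ gap) + ∑[ x < B zero ] ∑Δ ℓ B′ (F ∘ consΔ (sym x))
    ≡⟨ cong₂ _+_ gap-part sym-part ⟩
  f zero gap * ∑Δ ℓ B′ (λ w → indicator (suc (gapCount w) ℕ.≟ n) * P w) + s₀ * tail-sum n
    ≡⟨ split n ⟩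
  productCoeff n (λ i → f i gap) (λ i → ∑[ x < B i ] f i (sym x)) ∎
  where
  open ≡-Reasoning
  B′ : Fin ℓ → ℕ
  B′ = B ∘ suc
  F : ΔW (suc ℓ) B → ℤ
  F y = indicator (gapCount y ℕ.≟ n) * ∏[ i < suc ℓ ] f i (y i)
  P : ΔW ℓ B′ → ℤ
  P w = ∏[ i < ℓ ] f (suc i) (w i)
  s₀ : ℤ
  s₀ = ∑[ x < B zero ] f zero (sym x)
  tail-sum : ℕ → ℤ
  tail-sum m = ∑Δ ℓ B′ (λ w → indicator (gapCount w ℕ.≟ m) * P w)
  IH : ∀ m → tail-sum m ≡ productCoeff m (λ i → f (suc i) gap) (λ i → ∑[ x < B (suc i) ] f (suc i) (sym x))
  IH = ∑Δ-gapCount-∏ ℓ B′ (f ∘ suc)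

  gap-term : ∀ w → F (consΔ gap w) ≡ f zero gap * (indicator (suc (gapCount w) ℕ.≟ n) * P w)
  gap-term w =
    trans (cong (λ c → indicator (c ℕ.≟ n) * (f zero gap * P w)) (gapCount-gap (consΔ gap w) refl))
          (*-left-comm (indicator (suc (gapCount w) ℕ.≟ n)) (f zero gap) (P w))

  sym-term : ∀ x w → F (consΔ (sym x) w) ≡ f zero (sym x) * (indicator (gapCount w ℕ.≟ n) * P w)
  sym-term x w =
    trans (cong (λ c → indicator (c ℕ.≟ n) * (f zero (sym x) * P w)) (gapCount-sym (consΔ (sym x) w) refl))
          (*-left-comm (indicator (gapCount w ℕ.≟ n)) (f zero (sym x)) (P w))

  gap-part : ∑Δ ℓ B′ (F ∘ consΔ gap) ≡ f zero gap * ∑Δ ℓ B′ (λ w → indicator (suc (gapCount w) ℕ.≟ n) * P w)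
  gap-part = trans (∑Δ-cong ℓ B′ gap-term)
    (sumOver-*ˡ (allΔ ℓ B′) (f zero gap) (λ w → indicator (suc (gapCount w) ℕ.≟ n) * P w))

  sym-part : ∑[ x < B zero ] ∑Δ ℓ B′ (F ∘ consΔ (sym x)) ≡ s₀ * tail-sum n
  sym-part = trans
    (sum-cong-≗ {B zero} λ x → trans (∑Δ-cong ℓ B′ (sym-term x))
      (sumOver-*ˡ (allΔ ℓ B′) (f zero (sym x)) (λ w → indicator (gapCount w ℕ.≟ n) * P w)))
    (≡-sym (*-distribʳ-sum (tail-sum n) (λ x → f zero (sym x))))

  split : ∀ n → f zero gap * ∑Δ ℓ B′ (λ w → indicator (suc (gapCount w) ℕ.≟ n) * P w) + s₀ * tail-sum n
              ≡ productCoeff n (λ i → f i gap) (λ i → ∑[ x < B i ] f i (sym x))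
  -- For n = 0 the indicator of suc (gapCount w) ≡ 0 computes to + 0.
  split zero = begin
    f zero gap * ∑Δ ℓ B′ (λ _ → + 0) + s₀ * tail-sum zero
      ≡⟨ cong (λ z → f zero gap * z + s₀ * tail-sum zero) (sumOver-*ˡ (allΔ ℓ B′) (+ 0) P) ⟩
    f zero gap * + 0 + s₀ * tail-sum zero
      ≡⟨ cong₂ _+_ (ℤP.*-zeroʳ (f zero gap)) (cong (s₀ *_) (IH zero)) ⟩
    + 0 + s₀ * productCoeff zero (λ i → f (suc i) gap) (λ i → ∑[ x < B (suc i) ] f (suc i) (sym x))
      ≡⟨ ℤP.+-identityˡ _ ⟩
    productCoeff zero (λ i → f i gap) (λ i → ∑[ x < B i ] f i (sym x)) ∎
  split (suc m) = cong₂ _+_ (cong (f zero gap *_) (IH m)) (cong (s₀ *_) (IH (suc m)))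

productCoeff-ν-gap : ∀ {ℓ} (B : Fin ℓ → ℕ) (v′ : ΔW ℓ B) (s : Fin ℓ → ℤ) →
  (∀ i → v′ i ≡ gap → s i ≡ + 1) → ∀ n →
  productCoeff n (λ i → ν (B i) gap (v′ i)) s ≡ -1ℤ ^ n * S n (BofG B v′) * ∏[ i < ℓ ] s i
productCoeff-ν-gap {zero}  B v′ s s-gap zero    = refl
productCoeff-ν-gap {zero}  B v′ s s-gap (suc n) = ≡-sym (cong (_* + 1) (ℤP.*-zeroʳ (-1ℤ ^ suc n)))
productCoeff-ν-gap {suc ℓ} B v′ s s-gap = step
  where
  L : List ℕ
  L = BofG (B ∘ suc) (tailΔ v′)
  P : ℤ
  P = ∏[ i < ℓ ] s (suc i)
  C : ℕ → ℤ
  C n = productCoeff n (λ i → ν (B (suc i)) gap (v′ (suc i))) (s ∘ suc)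
  IH : ∀ n → C n ≡ -1ℤ ^ n * S n L * P
  IH = productCoeff-ν-gap (B ∘ suc) (tailΔ v′) (s ∘ suc) (s-gap ∘ suc)

  by-head : ∀ m a → v′ zero ≡ a →
    productCoeff (suc m) (λ i → ν (B i) gap (v′ i)) s ≡ -1ℤ ^ suc m * S (suc m) (BofG B v′) * (s zero * P)
  by-head m gap e rewrite BofG-gap v′ e | e | s-gap zero e = begin
    - + B zero * C m + + 1 * C (suc m)
      ≡⟨ cong₂ (λ x y → - + B zero * x + + 1 * y) (IH m) (IH (suc m)) ⟩
    - + B zero * (-1ℤ ^ m * S m L * P) + + 1 * (-1ℤ ^ suc m * S (suc m) L * P)
      ≡⟨ regroup (+ B zero) (-1ℤ ^ m) (S m L) (S (suc m) L) P ⟩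
    -1ℤ ^ suc m * (+ B zero * S m L + S (suc m) L) * (+ 1 * P) ∎
    where
    open ≡-Reasoning
    regroup : ∀ b e x x′ p → - b * (e * x * p) + + 1 * (-1ℤ * e * x′ * p) ≡ -1ℤ * e * (b * x + x′) * (+ 1 * p)
    regroup = solve-∀
  by-head m (sym y) e rewrite BofG-sym v′ e | e = begin
    + 0 * C m + s zero * C (suc m)
      ≡⟨ ℤP.+-identityˡ (s zero * C (suc m)) ⟩
    s zero * C (suc m)
      ≡⟨ cong (s zero *_) (IH (suc m)) ⟩
    s zero * (-1ℤ ^ suc m * S (suc m) L * P)
      ≡⟨ *-left-comm (s zero) (-1ℤ ^ suc m * S (suc m) L) P ⟩
    -1ℤ ^ suc m * S (suc m) L * (s zero * P) ∎
    where open ≡-Reasoning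

  step : ∀ n → productCoeff n (λ i → ν (B i) gap (v′ i)) s ≡ -1ℤ ^ n * S n (BofG B v′) * (s zero * P)
  step zero    = trans (cong (s zero *_) (IH zero)) (*-left-comm (s zero) (+ 1 * + 1) P)
  step (suc m) = by-head m (v′ zero) refl

indicator-matchable-*-νB : ∀ {ℓ} (B : Fin ℓ → ℕ) (u : ΣW ℓ B) (y x v′ : ΔW ℓ B) →
  indicator (matchable? u y) * νB B x v′ ≡ ∏[ i < ℓ ] (indicator (matches? (y i) (u i)) * ν (B i) (x i) (v′ i))
indicator-matchable-*-νB {ℓ} B u y x v′ = begin
  indicator (matchable? u y) * νB B x v′
    ≡⟨ cong₂ _*_ (indicator-all? (λ i → matches? (y i) (u i))) (νB-∏ B x v′) ⟩
  ∏[ i < ℓ ] indicator (matches? (y i) (u i)) * ∏[ i < ℓ ] ν (B i) (x i) (v′ i)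
    ≡⟨ ∏-distrib-* (λ i → indicator (matches? (y i) (u i))) (λ i → ν (B i) (x i) (v′ i)) ⟨
  ∏[ i < ℓ ] (indicator (matches? (y i) (u i)) * ν (B i) (x i) (v′ i)) ∎
  where open ≡-Reasoning

sumOver-M : ∀ ℓ k (B : Fin ℓ → ℕ) (u : ΣW ℓ B) (v′ : ΔW ℓ B) →
  sumOver (M B k u) (λ y → νB B y v′) ≡ -1ℤ ^ (ℓ ∸ k) * S (ℓ ∸ k) (BofG B v′) * νB B (emb u) v′
sumOver-M ℓ k B u v′ = begin
  sumOver (M B k u) (λ y → νB B y v′)
    ≡⟨ sumOver-filter (λ y → (gapCount y ℕ.≟ n) ×-dec matchable? u y) (allΔ ℓ B) (λ y → νB B y v′) ⟩
  ∑Δ ℓ B (λ y → indicator ((gapCount y ℕ.≟ n) ×-dec matchable? u y) * νB B y v′)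
    ≡⟨ ∑Δ-cong ℓ B weight ⟩
  ∑Δ ℓ B (λ y → indicator (gapCount y ℕ.≟ n) * ∏[ i < ℓ ] f i (y i))
    ≡⟨ ∑Δ-gapCount-∏ ℓ B f n ⟩
  productCoeff n (λ i → f i gap) (λ i → ∑[ x < B i ] f i (sym x))
    ≡⟨ productCoeff-cong n (λ i → ℤP.*-identityˡ (ν (B i) gap (v′ i))) (λ i → ∑-matches-sym (u i) (v′ i)) ⟩
  productCoeff n (λ i → ν (B i) gap (v′ i)) (λ i → ν (B i) (sym (u i)) (v′ i))
    ≡⟨ productCoeff-ν-gap B v′ (λ i → ν (B i) (sym (u i)) (v′ i)) ν-sym-gap n ⟩
  -1ℤ ^ n * S n (BofG B v′) * ∏[ i < ℓ ] ν (B i) (sym (u i)) (v′ i)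
    ≡⟨ cong (-1ℤ ^ n * S n (BofG B v′) *_) (νB-∏ B (emb u) v′) ⟨
  -1ℤ ^ n * S n (BofG B v′) * νB B (emb u) v′ ∎
  where
  open ≡-Reasoning
  n = ℓ ∸ k
  f : (i : Fin ℓ) → Δ (B i) → ℤ
  f i a = indicator (matches? a (u i)) * ν (B i) a (v′ i)
  weight : ∀ y → indicator ((gapCount y ℕ.≟ n) ×-dec matchable? u y) * νB B y v′
               ≡ indicator (gapCount y ℕ.≟ n) * ∏[ i < ℓ ] f i (y i)
  weight y = begin
    indicator ((gapCount y ℕ.≟ n) ×-dec matchable? u y) * νB B y v′
      ≡⟨ cong (_* νB B y v′) (indicator-× (gapCount y ℕ.≟ n) (matchable? u y)) ⟩
    indicator (gapCount y ℕ.≟ n) * indicator (matchable? u y) * νB B y v′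
      ≡⟨ ℤP.*-assoc (indicator (gapCount y ℕ.≟ n)) (indicator (matchable? u y)) (νB B y v′) ⟩
    indicator (gapCount y ℕ.≟ n) * (indicator (matchable? u y) * νB B y v′)
      ≡⟨ cong (indicator (gapCount y ℕ.≟ n) *_) (indicator-matchable-*-νB B u y y v′) ⟩
    indicator (gapCount y ℕ.≟ n) * ∏[ i < ℓ ] f i (y i) ∎
  ν-sym-gap : ∀ i → v′ i ≡ gap → ν (B i) (sym (u i)) (v′ i) ≡ + 1
  ν-sym-gap i e rewrite e = refl

sumOver-M′ : ∀ ℓ (B : Fin ℓ → ℕ) (v v′ : ΔW ℓ B) →
  sumOver (M′ B v) (λ u → νB B (emb u) v′) ≡ -1ℤ ^ gapCount v * νB B v v′
sumOver-M′ ℓ B v v′ = begin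
  sumOver (M′ B v) (λ u → νB B (emb u) v′)
    ≡⟨ sumOver-filter (λ u → matchable? u v) (allΣ ℓ B) (λ u → νB B (emb u) v′) ⟩
  ∑Σ ℓ B (λ u → indicator (matchable? u v) * νB B (emb u) v′)
    ≡⟨ ∑Σ-cong ℓ B (λ u → indicator-matchable-*-νB B u v (emb u) v′) ⟩
  ∑Σ ℓ B (λ u → ∏[ i < ℓ ] f i (u i))
    ≡⟨ ∑Σ-∏ ℓ B f ⟩
  ∏[ i < ℓ ] ∑[ x < B i ] f i x
    ≡⟨ ∏-cong-≗ {ℓ} (λ i → ∑-matches-ν (v i) (v′ i)) ⟩
  ∏[ i < ℓ ] (sgn (v i) * ν (B i) (v i) (v′ i))
    ≡⟨ ∏-distrib-* (λ i → sgn (v i)) (λ i → ν (B i) (v i) (v′ i)) ⟩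
  ∏[ i < ℓ ] sgn (v i) * ∏[ i < ℓ ] ν (B i) (v i) (v′ i)
    ≡⟨ cong₂ _*_ (≡-sym (∏-sgn v)) (νB-∏ B v v′) ⟨
  -1ℤ ^ gapCount v * νB B v v′ ∎
  where
  open ≡-Reasoning
  f : (i : Fin ℓ) → Fin (B i) → ℤ
  f i x = indicator (matches? (v i) x) * ν (B i) (sym x) (v′ i)

proposition2 : (ℓ k : ℕ) (B : Fin ℓ → ℕ) → 1 ≤ ℓ → k ≤ ℓ → (∀ i → 2 ≤ B i) →
    ((u : ΣW ℓ B) (v′ : ΔW ℓ B) → InV′≤ k v′ →
      sumℤ (map (λ y → νB B y v′) (M B k u))
        ≡ ((- (+ 1)) ^ (ℓ ∸ k)) * S (ℓ ∸ k) (BofG B v′) * νB B (emb u) v′)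
    × ((v v′ : ΔW ℓ B) → InV k v → InV′≤ k v′ →
      sumℤ (map (λ u → νB B (emb u) v′) (M′ B v))
        ≡ ((- (+ 1)) ^ (ℓ ∸ k)) * νB B v v′)
proposition2 ℓ k B _ _ _ =
  (λ u v′ _ → sumOver-M ℓ k B u v′) ,
  (λ v v′ v∈V _ → trans (sumOver-M′ ℓ B v v′) (cong (λ m → -1ℤ ^ m * νB B v v′) v∈V))
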